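{- Let $k\ge3$ be an integer. For all integers $t$ with $2k+1\le t\le k+2^k$ and all $n\ge t$ we have $\operatorname{Nak}^{\mathcal{S}}(n,t)\ge n-k$.
   Context: A simple game $(N,\mathcal{W})$: $N$ finite, $\mathcal{W}$ a family of subsets (winning coalitions) with $\emptyset\notin\mathcal{W}$, $N\in\mathcal{W}$, closed under supersets; a vetoer is a player in every winning coalition; the Nakamura number is the minimum number of winning coalitions with empty intersection. Write $i\sqsupseteq j$ if for every $S$ with $j\in S\subseteq N\setminus\{i\}$, $S\in\mathcal{W}$ implies $(S\setminus\{j\})\cup\{i\}\in\mathcal{W}$; $i,j$ are equivalent if $i\sqsupseteq j$ and $j\sqsupseteq i$. $\operatorname{Nak}^{\mathcal{S}}(n,t)$ is the maximum Nakamura number of a simple game without vetoers with $n$ players and exactly $t$ equivalence classes. -}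

module Defs where

open import Data.Nat using (ℕ; _≤_)
open import Data.Bool using (Bool; true; false)
open import Data.Fin using (Fin)
open import Data.Fin.Subset using (Subset; ⊥; ⊤; _⊆_; _∈_; _∉_; _∪_; _-_; ⁅_⁆; ⋂; Empty)
open import Data.List using (List; length)
open import Data.List.Relation.Unary.All using (All)
open import Data.Product using (Σ; ∃; _×_)
open import Relation.Binary.PropositionalEquality using (_≡_)
open import Relation.Nullary using (¬_)
open import Function.Bundles using (_⇔_)

record SimpleGame (n : ℕ) : Set where
  field
    win       : Subset n → Bool
    empty-los : win ⊥ ≡ false
    grand-win : win ⊤ ≡ true
    monotone  : ∀ {S T} → S ⊆ T → win S ≡ true → win T ≡ true

open SimpleGame public

module _ {n : ℕ} (G : SimpleGame n) where

  Winning : Subset n → Set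
  Winning S = win G S ≡ true

  Vetoer : Fin n → Set
  Vetoer i = ∀ S → Winning S → i ∈ S

  NoVetoers : Set
  NoVetoers = ∀ i → ¬ Vetoer i

  EmptyIntersectionFamily : List (Subset n) → Set
  EmptyIntersectionFamily Ss = All Winning Ss × Empty (⋂ Ss)

  IsNakamura : ℕ → Set
  IsNakamura ν =
    (Σ (List (Subset n)) λ Ss → EmptyIntersectionFamily Ss × length Ss ≡ ν)
    × (∀ Ss → EmptyIntersectionFamily Ss → ν ≤ length Ss)

  _⊒_ : Fin n → Fin n → Set
  i ⊒ j = ∀ S → j ∈ S → i ∉ S → Winning S → Winning ((S - j) ∪ ⁅ i ⁆)

  Equivalent : Fin n → Fin n → Set
  Equivalent i j = (i ⊒ j) × (j ⊒ i)

  -- The players split into exactly t equivalence classes: there is a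
  -- surjection Fin n → Fin t whose fibres are exactly the classes.
  HasClasses : ℕ → Set
  HasClasses t =
    Σ (Fin n → Fin t) λ f →
      (∀ c → ∃ λ i → f i ≡ c) × (∀ i j → (f i ≡ f j) ⇔ Equivalent i j)

-- Nak^S(n,t) ≥ m : the maximum Nakamura number over vetoer-free simple
-- games with n players and exactly t equivalence classes is at least m,
-- i.e. some such game has Nakamura number at least m.
NakS-atLeast : ℕ → ℕ → ℕ → Set
NakS-atLeast n t m =
  Σ (SimpleGame n) λ G → NoVetoers G × HasClasses G t ×
    ∃ λ ν → IsNakamura G ν × m ≤ ν

-- Let the players be M + 1 keys and N regular players, and call a coalition winning when the
-- players it leaves out are pairwise free of conflict, where any two regulars conflict, no two
-- keys do, and a regular of type τ conflicts with the keys at which the binary expansion of τ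
-- has digit 1.  The Nakamura number of such a game is the chromatic number of its conflict
-- graph: the regulars form an N-clique, and colouring every key like the regular of type 0
-- uses only N colours.  Desirability is read off neighbourhoods (i ⊒ j iff every neighbour
-- of j other than i is a neighbour of i), so two regulars are equivalent iff they share a
-- type, while distinct keys, and keys against regulars, are told apart by the types 0 and 2^c.
-- With t − (M + 1) types, 2^M ≤ t − (M + 1) ≤ 2^(M+1), there are exactly t classes, and the
-- bounds on t guarantee such an M with M + 1 ≤ k, so N = n − (M + 1) ≥ n − k.
module Submission where

open import Defs
open import Data.Nat using (ℕ; zero; suc; _≤_; _<_; _+_; _*_; _^_; _∸_; z≤n; s≤s; s≤s⁻¹)
open import Data.Nat.Properties
  using (≤-refl; ≤-trans; ≤-reflexive; <-≤-trans; n≤1+n; <⇒≱; ≮⇒≥; _<?_; m≤n⇒m<n∨m≡n;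
         *-zeroʳ; +-comm; +-assoc; +-monoˡ-≤; *-monoʳ-≤; ∸-monoʳ-≤; m+[n∸m]≡n; m+n∸m≡n;
         m+n≤o⇒m≤o; m+n≤o⇒m≤o∸n; m≤n+o⇒m∸n≤o; module ≤-Reasoning)
open import Data.Bool using (true)
open import Data.Empty using () renaming (⊥ to Void)
import Data.Fin as Fin
open import Data.Fin
  using (Fin; _↑ˡ_; toℕ; fromℕ<; inject≤; splitAt; join; combine; funToFin; finToFun; _≟_)
open import Data.Fin.Patterns using (0F; 1F)
open import Data.Fin.Properties
  using (toℕ-injective; toℕ-fromℕ<; toℕ-inject≤; inject≤-injective; toℕ<n; toℕ-combine;
         splitAt-join; join-splitAt; splitAt-↑ˡ; 0≢1+n; ¬∀⟶∃¬; all?; injective⇒≤;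
         funToFin-finToFin; finToFun-funToFin)
open import Data.Fin.Subset using (Subset; ⊥; ⊤; _∈_; _∉_; _∪_; _-_; _─_; ⁅_⁆; ∁; ⋂; inside)
open import Data.Fin.Subset.Properties
  using (_∈?_; ∉⊥; ∈⊤; x∈⁅x⁆; x∈⁅y⁆⇒x≡y; x∈∁p⇒x∉p; x∉∁p⇒x∈p; x∉p⇒x∈∁p; x∈p∪q⁻; x∈p∪q⁺;
         x∈p∩q⁻; x∈p∩q⁺; x∈p∧x≢y⇒x∈p-y; p─q⊆p)
open import Data.Vec using (_∷_; here; there; tabulate)
open import Data.Vec.Properties using ([]=⇒lookup; lookup⇒[]=; lookup∘tabulate)
open import Data.List as List using (List; length)
open import Data.List.Properties using (length-tabulate)
open import Data.List.Relation.Unary.All using (All; lookupAny) renaming (_∷_ to _∷ᴬ_; [] to []ᴬ)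
open import Data.List.Relation.Unary.All.Properties using (tabulate⁺; tabulate⁻)
open import Data.List.Relation.Unary.Any using (Any; here; there; index)
open import Data.Product using (Σ; ∃; _×_; _,_; proj₁; proj₂)
open import Data.Sum using (_⊎_; inj₁; inj₂; [_,_]′; map₂)
open import Data.Sum.Properties using (inj₂-injective)
open import Function using (_∘_; const; id)
open import Function.Bundles using (_⇔_; mk⇔; Equivalence)
open import Relation.Binary.Definitions using (Decidable; Symmetric)
open import Relation.Binary.PropositionalEquality
  using (_≡_; _≢_; refl; sym; trans; cong; cong₂; subst; subst₂; _≗_; module ≡-Reasoning)
open import Relation.Nullary using (¬_; Dec; yes; no; does; contradiction)
open import Relation.Nullary.Decidable using (dec-true; dec-false; ¬?; _→-dec_)

open Equivalence using (to; from)

-- Coalitions missing few players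

module _ {n : ℕ} {x y z : Fin n} where

  ∉pair⇒≡ : z ∉ ∁ (⁅ x ⁆ ∪ ⁅ y ⁆) → z ≡ x ⊎ z ≡ y
  ∉pair⇒≡ z∉ with x∈p∪q⁻ ⁅ x ⁆ ⁅ y ⁆ (x∉∁p⇒x∈p z∉)
  ... | inj₁ z∈⁅x⁆ = inj₁ (x∈⁅y⁆⇒x≡y x z∈⁅x⁆)
  ... | inj₂ z∈⁅y⁆ = inj₂ (x∈⁅y⁆⇒x≡y y z∈⁅y⁆)

  ≢⇒∈pair : z ≢ x → z ≢ y → z ∈ ∁ (⁅ x ⁆ ∪ ⁅ y ⁆)
  ≢⇒∈pair z≢x z≢y = x∉p⇒x∈∁p λ z∈ →
    [ z≢x ∘ x∈⁅y⁆⇒x≡y x , z≢y ∘ x∈⁅y⁆⇒x≡y y ]′ (x∈p∪q⁻ ⁅ x ⁆ ⁅ y ⁆ z∈)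

∉pairˡ : ∀ {n} {x y : Fin n} → x ∉ ∁ (⁅ x ⁆ ∪ ⁅ y ⁆)
∉pairˡ {x = x} x∈ = x∈∁p⇒x∉p x∈ (x∈p∪q⁺ (inj₁ (x∈⁅x⁆ x)))

∉pairʳ : ∀ {n} {x y : Fin n} → y ∉ ∁ (⁅ x ⁆ ∪ ⁅ y ⁆)
∉pairʳ {y = y} y∈ = x∈∁p⇒x∉p y∈ (x∈p∪q⁺ (inj₂ (x∈⁅x⁆ y)))

x∈p─q⇒x∉q : ∀ {n} {x : Fin n} (p q : Subset n) → x ∈ p ─ q → x ∉ q
x∈p─q⇒x∉q (_ ∷ p) (_ ∷ q)      (there x∈p─q) (there x∈q) = x∈p─q⇒x∉q p q x∈p─q x∈q
x∈p─q⇒x∉q (_ ∷ p) (inside ∷ q) ()            here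

module _ {n : ℕ} {S : Subset n} {i j z : Fin n} where

  ∉swap⇒ : z ∉ (S - j) ∪ ⁅ i ⁆ → z ≢ i × (z ≡ j ⊎ z ∉ S)
  ∉swap⇒ z∉ = (λ { refl → z∉ (x∈p∪q⁺ (inj₂ (x∈⁅x⁆ i))) }) , z≡j⊎z∉S
    where
    z≡j⊎z∉S : z ≡ j ⊎ z ∉ S
    z≡j⊎z∉S with z ≟ j
    ... | yes z≡j = inj₁ z≡j
    ... | no z≢j  = inj₂ λ z∈S → z∉ (x∈p∪q⁺ (inj₁ (x∈p∧x≢y⇒x∈p-y z∈S z≢j)))

  ∉swap⁺ : z ≢ i → z ≡ j ⊎ z ∉ S → z ∉ (S - j) ∪ ⁅ i ⁆
  ∉swap⁺ z≢i z≡j⊎z∉S z∈ with x∈p∪q⁻ (S - j) ⁅ i ⁆ z∈ | z≡j⊎z∉S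
  ... | inj₂ z∈⁅i⁆ | _         = z≢i (x∈⁅y⁆⇒x≡y i z∈⁅i⁆)
  ... | inj₁ z∈S-j | inj₁ refl = x∈p─q⇒x∉q S ⁅ j ⁆ z∈S-j (x∈⁅x⁆ j)
  ... | inj₁ z∈S-j | inj₂ z∉S  = z∉S (p─q⊆p S ⁅ j ⁆ z∈S-j)

module _ {n : ℕ} {x : Fin n} where

  ∈⋂⇒All∈ : ∀ Ss → x ∈ ⋂ Ss → All (x ∈_) Ss
  ∈⋂⇒All∈ List.[]       _  = []ᴬ
  ∈⋂⇒All∈ (S List.∷ Ss) x∈ = let x∈S , x∈⋂Ss = x∈p∩q⁻ S (⋂ Ss) x∈ in x∈S ∷ᴬ ∈⋂⇒All∈ Ss x∈⋂Ss

  ∉⋂⇒Any∉ : ∀ Ss → x ∉ ⋂ Ss → Any (x ∉_) Ss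
  ∉⋂⇒Any∉ List.[] x∉ = contradiction ∈⊤ x∉
  ∉⋂⇒Any∉ (S List.∷ Ss) x∉ with x ∈? S
  ... | no x∉S  = here x∉S
  ... | yes x∈S = there (∉⋂⇒Any∉ Ss λ x∈⋂Ss → x∉ (x∈p∩q⁺ (x∈S , x∈⋂Ss)))

-- Simple games of conflict graphs

⊒-refl : ∀ {n} (G : SimpleGame n) {i} → _⊒_ G i i
⊒-refl G S i∈S i∉S _ = contradiction i∈S i∉S

does-sound : ∀ {P : Set} (P? : Dec P) → does P? ≡ true → P
does-sound (yes p) _ = p

module GraphGame {n : ℕ} (_~_ : Fin n → Fin n → Set) (_~?_ : Decidable _~_)
                 (~-irrefl : ∀ {x} → ¬ x ~ x) (~-sym : Symmetric _~_) where

  IndependentComplement : Subset n → Set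
  IndependentComplement S = ∀ x y → x ∉ S → y ∉ S → ¬ x ~ y

  independentComplement? : ∀ S → Dec (IndependentComplement S)
  independentComplement? S =
    all? λ x → all? λ y → ¬? (x ∈? S) →-dec ¬? (y ∈? S) →-dec ¬? (x ~? y)

  Dominates : Fin n → Fin n → Set
  Dominates i j = ∀ x → x ≢ i → x ≢ j → x ~ j → x ~ i

  ∁pair-independent : ∀ {x y} → ¬ x ~ y → IndependentComplement (∁ (⁅ x ⁆ ∪ ⁅ y ⁆))
  ∁pair-independent x≁y a b a∉ b∉ with ∉pair⇒≡ a∉ | ∉pair⇒≡ b∉
  ... | inj₁ refl | inj₁ refl = ~-irrefl
  ... | inj₁ refl | inj₂ refl = x≁y
  ... | inj₂ refl | inj₁ refl = x≁y ∘ ~-sym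
  ... | inj₂ refl | inj₂ refl = ~-irrefl

  module Nontrivial {x₀ y₀ : Fin n} (edge : x₀ ~ y₀) where

    game : SimpleGame n
    game = record
      { win       = does ∘ independentComplement?
      ; empty-los = dec-false (independentComplement? ⊥) λ ind → ind x₀ y₀ ∉⊥ ∉⊥ edge
      ; grand-win = dec-true (independentComplement? ⊤) λ x _ x∉⊤ → contradiction ∈⊤ x∉⊤
      ; monotone  = λ {S} {S′} S⊆S′ S-wins → dec-true (independentComplement? S′) λ x y x∉ y∉ →
                      does-sound (independentComplement? S) S-wins x y (x∉ ∘ S⊆S′) (y∉ ∘ S⊆S′)
      }

    winning⇔ : ∀ {S} → Winning game S ⇔ IndependentComplement S
    winning⇔ {S} = mk⇔ (does-sound (independentComplement? S)) (dec-true (independentComplement? S))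

    noVetoers : NoVetoers game
    noVetoers i veto = x∈∁p⇒x∉p (veto (∁ ⁅ i ⁆) (from winning⇔ only-i)) (x∈⁅x⁆ i)
      where
      only-i : IndependentComplement (∁ ⁅ i ⁆)
      only-i x y x∉ y∉
        with refl ← x∈⁅y⁆⇒x≡y i (x∉∁p⇒x∈p x∉) | refl ← x∈⁅y⁆⇒x≡y i (x∉∁p⇒x∈p y∉) = ~-irrefl

    -- Swapping i for j in the coalition missing exactly x and i leaves exactly x and j out.
    ⊒⇒Dominates : ∀ {i j} → _⊒_ game i j → Dominates i j
    ⊒⇒Dominates {i} {j} i⊒j x x≢i x≢j x~j with x ~? i | i ≟ j
    ... | yes x~i | _       = x~i
    ... | no _    | yes refl = x~j
    ... | no x≁i  | no i≢j  = contradiction x~j (swapped-independent x j x∉swapped j∉swapped)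
      where
      swapped-independent : IndependentComplement ((∁ (⁅ x ⁆ ∪ ⁅ i ⁆) - j) ∪ ⁅ i ⁆)
      swapped-independent = to winning⇔ (i⊒j _ (≢⇒∈pair (x≢j ∘ sym) (i≢j ∘ sym)) ∉pairʳ
                                               (from winning⇔ (∁pair-independent x≁i)))
      x∉swapped = ∉swap⁺ x≢i (inj₂ ∉pairˡ)
      j∉swapped = ∉swap⁺ (i≢j ∘ sym) (inj₁ refl)

    Dominates⇒⊒ : ∀ {i j} → Dominates i j → _⊒_ game i j
    Dominates⇒⊒ {i} {j} dom S j∈S i∉S S-wins =
      from winning⇔ λ a b a∉ b∉ → missing-pair (∉swap⇒ a∉) (∉swap⇒ b∉)
      where
      S-independent = to winning⇔ S-wins

      outsider≁j : ∀ {b} → b ≢ i → b ∉ S → ¬ b ~ j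
      outsider≁j {b} b≢i b∉S b~j with b ≟ j
      ... | yes refl = b∉S j∈S
      ... | no b≢j   = S-independent b i b∉S i∉S (dom b b≢i b≢j b~j)

      missing-pair : ∀ {a b} → a ≢ i × (a ≡ j ⊎ a ∉ S) → b ≢ i × (b ≡ j ⊎ b ∉ S) → ¬ a ~ b
      missing-pair (_   , inj₁ refl) (_   , inj₁ refl) = ~-irrefl
      missing-pair (_   , inj₁ refl) (b≢i , inj₂ b∉S)  = outsider≁j b≢i b∉S ∘ ~-sym
      missing-pair (a≢i , inj₂ a∉S)  (_   , inj₁ refl) = outsider≁j a≢i a∉S
      missing-pair (_   , inj₂ a∉S)  (_   , inj₂ b∉S)  = S-independent _ _ a∉S b∉S

    clique⇒≤length : ∀ {m} (c : Fin m → Fin n) → (∀ {j j′} → j ≢ j′ → c j ~ c j′) →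
                     ∀ Ss → EmptyIntersectionFamily game Ss → m ≤ length Ss
    clique⇒≤length c clique Ss (winners , empty) = injective⇒≤ missed-injective
      where
      missed : ∀ j → Any (c j ∉_) Ss
      missed j = ∉⋂⇒Any∉ Ss λ cj∈⋂ → empty (c j , cj∈⋂)

      missed-injective : ∀ {j j′} → index (missed j) ≡ index (missed j′) → j ≡ j′
      missed-injective {j} {j′} same with j ≟ j′
      ... | yes j≡j′ = j≡j′
      ... | no j≢j′  = contradiction (clique j≢j′) (to winning⇔ S-wins (c j) (c j′) cj∉S cj′∉S)
        where
        S-wins = proj₁ (lookupAny winners (missed j))
        cj∉S   = proj₂ (lookupAny winners (missed j))
        cj′∉S  = subst (c j′ ∉_) (cong (List.lookup Ss) (sym same))
                       (proj₂ (lookupAny winners (missed j′)))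

    colouring⇒family : ∀ {m} (col : Fin n → Fin m) → (∀ {x y} → x ~ y → col x ≢ col y) →
                       Σ (List (Subset n)) λ Ss → EmptyIntersectionFamily game Ss × length Ss ≡ m
    colouring⇒family col proper =
      List.tabulate uncoloured , (tabulate⁺ uncoloured-wins , empty) , length-tabulate uncoloured
      where
      colourClass : Fin _ → Subset n
      colourClass k = tabulate λ x → does (col x ≟ k)

      ∈colourClass : ∀ {x k} → x ∈ colourClass k → col x ≡ k
      ∈colourClass {x} {k} x∈ =
        does-sound (col x ≟ k) (trans (sym (lookup∘tabulate _ x)) ([]=⇒lookup x∈))

      colourClass∋ : ∀ x → x ∈ colourClass (col x)
      colourClass∋ x = lookup⇒[]= x _ (trans (lookup∘tabulate _ x) (dec-true (col x ≟ col x) refl))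

      uncoloured : Fin _ → Subset n
      uncoloured k = ∁ (colourClass k)

      uncoloured-wins : ∀ k → Winning game (uncoloured k)
      uncoloured-wins k = from winning⇔ λ x y x∉ y∉ x~y →
        proper x~y (trans (∈colourClass (x∉∁p⇒x∈p x∉)) (sym (∈colourClass (x∉∁p⇒x∈p y∉))))

      empty : ¬ ∃ λ x → x ∈ ⋂ (List.tabulate uncoloured)
      empty (x , x∈⋂) = x∈∁p⇒x∉p (tabulate⁻ (∈⋂⇒All∈ _ x∈⋂) (col x)) (colourClass∋ x)

    clique-colouring⇒isNakamura : ∀ {m} (c : Fin m → Fin n) → (∀ {j j′} → j ≢ j′ → c j ~ c j′) →
                                  (col : Fin n → Fin m) → (∀ {x y} → x ~ y → col x ≢ col y) →
                                  IsNakamura game m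
    clique-colouring⇒isNakamura c clique col proper =
      colouring⇒family col proper , clique⇒≤length c clique

-- Key games

splitAt-elim : ∀ m n (P : Fin (m + n) → Set) → (∀ p → P (join m n p)) → ∀ x → P x
splitAt-elim m n P P-join x = subst P (join-splitAt m n x) (P-join (splitAt m x))

join-injective : ∀ m n {p q} → join m n p ≡ join m n q → p ≡ q
join-injective m n {p} {q} p≡q =
  trans (sym (splitAt-join m n p)) (trans (cong (splitAt m) p≡q) (splitAt-join m n q))

≢⇒0F,1F : ∀ {a a′ : Fin 2} → a ≢ a′ → (a ≡ 0F × a′ ≡ 1F) ⊎ (a ≡ 1F × a′ ≡ 0F)
≢⇒0F,1F {0F} {0F} a≢a′ = contradiction refl a≢a′
≢⇒0F,1F {0F} {1F} _    = inj₁ (refl , refl)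
≢⇒0F,1F {1F} {0F} _    = inj₂ (refl , refl)
≢⇒0F,1F {1F} {1F} a≢a′ = contradiction refl a≢a′

≡0F⇒≢1F : ∀ {a : Fin 2} → a ≡ 0F → a ≢ 1F
≡0F⇒≢1F refl ()

-- Row τ marks with 1F the keys that a regular player of type τ conflicts with.
record KeyTable (L T : ℕ) : Set where
  field
    row           : Fin T → Fin L → Fin 2
    row-injective : ∀ {τ τ′} → (∀ b → row τ b ≡ row τ′ b) → τ ≡ τ′
    blank         : Fin T
    blank-row     : ∀ b → row blank b ≡ 0F
    separating    : ∀ {b b′} → b ≢ b′ → ∃ λ τ → row τ b ≢ row τ b′
    avoiding      : ∀ b → ∃ λ τ → τ ≢ blank × row τ b ≡ 0F

-- τ₁ ≢ blank supplies two distinct regular players, i.e. a conflict, so that ∅ loses.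
module KeyGame {L T N : ℕ} (𝒯 : KeyTable L T) (ty : Fin N → Fin T)
               (ty-surjective : ∀ τ → ∃ λ j → ty j ≡ τ)
               {τ₁ : Fin T} (τ₁≢blank : τ₁ ≢ KeyTable.blank 𝒯) where

  open KeyTable 𝒯

  Adj : Fin L ⊎ Fin N → Fin L ⊎ Fin N → Set
  Adj (inj₁ _) (inj₁ _)  = Void
  Adj (inj₁ b) (inj₂ j)  = row (ty j) b ≡ 1F
  Adj (inj₂ j) (inj₁ b)  = row (ty j) b ≡ 1F
  Adj (inj₂ j) (inj₂ j′) = j ≢ j′

  adj? : Decidable Adj
  adj? (inj₁ _) (inj₁ _)  = no λ ()
  adj? (inj₁ b) (inj₂ j)  = row (ty j) b ≟ 1F
  adj? (inj₂ j) (inj₁ b)  = row (ty j) b ≟ 1F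
  adj? (inj₂ j) (inj₂ j′) = ¬? (j ≟ j′)

  adj-irrefl : ∀ {p} → ¬ Adj p p
  adj-irrefl {inj₂ j} j≢j = j≢j refl

  adj-sym : Symmetric Adj
  adj-sym {inj₁ _} {inj₂ _} = id
  adj-sym {inj₂ _} {inj₁ _} = id
  adj-sym {inj₂ _} {inj₂ _} j≢j′ = j≢j′ ∘ sym

  _~_ : Fin (L + N) → Fin (L + N) → Set
  x ~ y = Adj (splitAt L x) (splitAt L y)

  open GraphGame _~_ (λ x y → adj? (splitAt L x) (splitAt L y)) adj-irrefl adj-sym

  player : Fin L ⊎ Fin N → Fin (L + N)
  player = join L N

  K : Fin L → Fin (L + N)
  K = player ∘ inj₁

  R : Fin N → Fin (L + N)
  R = player ∘ inj₂

  player~⇔ : ∀ p q → player p ~ player q ⇔ Adj p q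
  player~⇔ p q = mk⇔ (subst₂ Adj (splitAt-join L N p) (splitAt-join L N q))
                     (subst₂ Adj (sym (splitAt-join L N p)) (sym (splitAt-join L N q)))

  regular : Fin T → Fin N
  regular = proj₁ ∘ ty-surjective

  ty-regular : ∀ τ → ty (regular τ) ≡ τ
  ty-regular = proj₂ ∘ ty-surjective

  regular-row : ∀ τ b → row (ty (regular τ)) b ≡ row τ b
  regular-row τ b = cong (λ σ → row σ b) (ty-regular τ)

  regular-injective : ∀ {τ τ′} → regular τ ≡ regular τ′ → τ ≡ τ′
  regular-injective {τ} {τ′} e = trans (sym (ty-regular τ)) (trans (cong ty e) (ty-regular τ′))

  j₀ : Fin N
  j₀ = regular blank

  j₀-row : ∀ b → row (ty j₀) b ≡ 0F
  j₀-row b = trans (regular-row blank b) (blank-row b)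

  open Nontrivial {R j₀} {R (regular τ₁)}
    (from (player~⇔ (inj₂ j₀) (inj₂ (regular τ₁))) (τ₁≢blank ∘ sym ∘ regular-injective))

  colour : Fin L ⊎ Fin N → Fin N
  colour (inj₁ _) = j₀
  colour (inj₂ j) = j

  colour-proper : ∀ {p q} → Adj p q → colour p ≢ colour q
  colour-proper {inj₁ b} {inj₂ j}  conflict refl = ≡0F⇒≢1F (j₀-row b) conflict
  colour-proper {inj₂ j} {inj₁ b}  conflict refl = ≡0F⇒≢1F (j₀-row b) conflict
  colour-proper {inj₂ j} {inj₂ j′} j≢j′ = j≢j′

  isNakamura : IsNakamura game N
  isNakamura = clique-colouring⇒isNakamura R (from (player~⇔ (inj₂ _) (inj₂ _)))
                                             (colour ∘ splitAt L) colour-proper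

  ¬⊒-witness : ∀ p q r → r ≢ p → r ≢ q → ¬ Adj r p → Adj r q → ¬ _⊒_ game (player p) (player q)
  ¬⊒-witness p q r r≢p r≢q r≁p r~q p⊒q = r≁p (to (player~⇔ r p)
    (⊒⇒Dominates p⊒q (player r) (r≢p ∘ join-injective L N) (r≢q ∘ join-injective L N)
                     (from (player~⇔ r q) r~q)))

  keys-inequivalent : ∀ {b b′} → b ≢ b′ → ¬ Equivalent game (K b) (K b′)
  keys-inequivalent {b} {b′} b≢b′ (b⊒b′ , b′⊒b)
      with τ , rows-differ ← separating b≢b′
      with ≢⇒0F,1F (subst (λ σ → row σ b ≢ row σ b′) (sym (ty-regular τ)) rows-differ)
  ... | inj₁ (b-free , b′-conflict) =
    ¬⊒-witness (inj₁ b) (inj₁ b′) (inj₂ (regular τ)) (λ ()) (λ ()) (≡0F⇒≢1F b-free) b′-conflict b⊒b′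
  ... | inj₂ (b-conflict , b′-free) =
    ¬⊒-witness (inj₁ b′) (inj₁ b) (inj₂ (regular τ)) (λ ()) (λ ()) (≡0F⇒≢1F b′-free) b-conflict b′⊒b

  key⋣regular : ∀ b j → ¬ _⊒_ game (K b) (R j)
  key⋣regular b j with τ , τ≢blank , τ-free ← avoiding b | j ≟ j₀
  ... | yes refl = ¬⊒-witness (inj₁ b) (inj₂ j₀) (inj₂ (regular τ)) (λ ())
                     (τ≢blank ∘ regular-injective ∘ inj₂-injective)
                     (≡0F⇒≢1F (trans (regular-row τ b) τ-free)) (τ≢blank ∘ regular-injective)
  ... | no j≢j₀  = ¬⊒-witness (inj₁ b) (inj₂ j) (inj₂ j₀) (λ ())
                     (j≢j₀ ∘ sym ∘ inj₂-injective) (≡0F⇒≢1F (j₀-row b)) (j≢j₀ ∘ sym)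

  regulars-inequivalent : ∀ {j j′} → ty j ≢ ty j′ → ¬ Equivalent game (R j) (R j′)
  regulars-inequivalent {j} {j′} ty≢ (j⊒j′ , j′⊒j)
      with b , rows-differ ← ¬∀⟶∃¬ L _ (λ b → row (ty j) b ≟ row (ty j′) b) (ty≢ ∘ row-injective)
      with ≢⇒0F,1F rows-differ
  ... | inj₁ (j-free , j′-conflict) =
    ¬⊒-witness (inj₂ j) (inj₂ j′) (inj₁ b) (λ ()) (λ ()) (≡0F⇒≢1F j-free) j′-conflict j⊒j′
  ... | inj₂ (j-conflict , j′-free) =
    ¬⊒-witness (inj₂ j′) (inj₂ j) (inj₁ b) (λ ()) (λ ()) (≡0F⇒≢1F j′-free) j-conflict j′⊒j

  sameType⇒Dominates : ∀ {j j′} → ty j ≡ ty j′ → Dominates (R j) (R j′)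
  sameType⇒Dominates {j} {j′} ty≡ =
    splitAt-elim L N (λ x → x ≢ R j → x ≢ R j′ → x ~ R j′ → x ~ R j) twin
    where
    twin : ∀ p → player p ≢ R j → player p ≢ R j′ → player p ~ R j′ → player p ~ R j
    twin (inj₁ b) _ _ conflict = from (player~⇔ (inj₁ b) (inj₂ j))
      (subst (λ σ → row σ b ≡ 1F) (sym ty≡) (to (player~⇔ (inj₁ b) (inj₂ j′)) conflict))
    twin (inj₂ r) r≢j _ _ = from (player~⇔ (inj₂ r) (inj₂ j)) (r≢j ∘ cong R)

  type : Fin L ⊎ Fin N → Fin L ⊎ Fin T
  type = map₂ ty

  sameType⇒equivalent : ∀ p q → type p ≡ type q → Equivalent game (player p) (player q)
  sameType⇒equivalent (inj₁ b) (inj₁ .b) refl = ⊒-refl game , ⊒-refl game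
  sameType⇒equivalent (inj₂ j) (inj₂ j′) e =
    Dominates⇒⊒ (sameType⇒Dominates (inj₂-injective e)) ,
    Dominates⇒⊒ (sameType⇒Dominates (sym (inj₂-injective e)))

  equivalent⇒sameType : ∀ p q → Equivalent game (player p) (player q) → type p ≡ type q
  equivalent⇒sameType (inj₁ b) (inj₁ b′) equiv with b ≟ b′
  ... | yes b≡b′ = cong inj₁ b≡b′
  ... | no b≢b′  = contradiction equiv (keys-inequivalent b≢b′)
  equivalent⇒sameType (inj₁ b) (inj₂ j) (b⊒j , _) = contradiction b⊒j (key⋣regular b j)
  equivalent⇒sameType (inj₂ j) (inj₁ b) (_ , b⊒j) = contradiction b⊒j (key⋣regular b j)
  equivalent⇒sameType (inj₂ j) (inj₂ j′) equiv with ty j ≟ ty j′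
  ... | yes ty≡ = cong inj₂ ty≡
  ... | no ty≢  = contradiction equiv (regulars-inequivalent ty≢)

  classOf : Fin (L + N) → Fin (L + T)
  classOf = join L T ∘ type ∘ splitAt L

  classOf-player : ∀ p → classOf (player p) ≡ join L T (type p)
  classOf-player p = cong (join L T ∘ type) (splitAt-join L N p)

  classOf-surjective : ∀ c → ∃ λ x → classOf x ≡ c
  classOf-surjective = splitAt-elim L T (λ c → ∃ λ x → classOf x ≡ c) λ
    { (inj₁ b) → K b , classOf-player (inj₁ b)
    ; (inj₂ τ) → R (regular τ) ,
                 trans (classOf-player (inj₂ (regular τ))) (cong (join L T ∘ inj₂) (ty-regular τ))
    }

  sameClass⇔equivalent : ∀ p q →
    (classOf (player p) ≡ classOf (player q)) ⇔ Equivalent game (player p) (player q)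
  sameClass⇔equivalent p q = mk⇔
    (λ same → sameType⇒equivalent p q
      (join-injective L T (trans (sym (classOf-player p)) (trans same (classOf-player q)))))
    (λ equiv → trans (classOf-player p)
      (trans (cong (join L T) (equivalent⇒sameType p q equiv)) (sym (classOf-player q))))

  hasClasses : HasClasses game (L + T)
  hasClasses = classOf , classOf-surjective , λ x y →
    splitAt-elim L N (λ x → ∀ y → (classOf x ≡ classOf y) ⇔ Equivalent game x y)
      (λ p → splitAt-elim L N _ (sameClass⇔equivalent p)) x y

  nakS-atLeast : NakS-atLeast (L + N) (L + T) N
  nakS-atLeast = game , noVetoers , hasClasses , N , isNakamura , ≤-refl

-- Binary key tables

funToFin-cong : ∀ {m n} {f g : Fin m → Fin n} → f ≗ g → funToFin f ≡ funToFin g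
funToFin-cong {zero}  _   = refl
funToFin-cong {suc m} f≗g = cong₂ combine (f≗g 0F) (funToFin-cong (f≗g ∘ Fin.suc))

finToFun-injective : ∀ {m n} {i j : Fin (m ^ n)} → finToFun {m} {n} i ≗ finToFun j → i ≡ j
finToFun-injective {m} {n} {i} {j} same =
  trans (sym (funToFin-finToFin {n} {m} i))
        (trans (funToFin-cong same) (funToFin-finToFin {n} {m} j))

-- funToFin reads digit 0F as the most significant one.
toℕ-funToFin< : ∀ {M} (f : Fin (suc M) → Fin 2) → f 0F ≡ 0F → toℕ (funToFin f) < 2 ^ M
toℕ-funToFin< {M} f f0≡0 = begin-strict
  toℕ (funToFin f)               ≡⟨ toℕ-combine (f 0F) rest ⟩
  2 ^ M * toℕ (f 0F) + toℕ rest  ≡⟨ cong (λ d → 2 ^ M * toℕ d + toℕ rest) f0≡0 ⟩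
  2 ^ M * 0 + toℕ rest           ≡⟨ cong (_+ toℕ rest) (*-zeroʳ (2 ^ M)) ⟩
  toℕ rest                       <⟨ toℕ<n rest ⟩
  2 ^ M                          ∎
  where
  open ≤-Reasoning
  rest = funToFin (f ∘ Fin.suc)

indicator : ∀ {L} → Fin L → Fin L → Fin 2
indicator c b with b ≟ c
... | yes _ = 1F
... | no _  = 0F

indicator-self : ∀ {L} (c : Fin L) → indicator c c ≡ 1F
indicator-self c with c ≟ c
... | yes _  = refl
... | no c≢c = contradiction refl c≢c

indicator-other : ∀ {L} {b c : Fin L} → b ≢ c → indicator c b ≡ 0F
indicator-other {b = b} {c} b≢c with b ≟ c
... | yes b≡c = contradiction b≡c b≢c
... | no _    = refl

module BinaryRows {M T : ℕ} (2^M≤T : 2 ^ M ≤ T) (T≤2^1+M : T ≤ 2 ^ suc M) where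

  binaryRow : Fin T → Fin (suc M) → Fin 2
  binaryRow τ = finToFun (inject≤ τ T≤2^1+M)

  binaryRow-injective : ∀ {τ τ′} → (∀ b → binaryRow τ b ≡ binaryRow τ′ b) → τ ≡ τ′
  binaryRow-injective same = inject≤-injective _ _ _ _ (finToFun-injective {2} {suc M} same)

  realise : (f : Fin (suc M) → Fin 2) → f 0F ≡ 0F → Fin T
  realise f f0≡0 = fromℕ< (<-≤-trans (toℕ-funToFin< f f0≡0) 2^M≤T)

  binaryRow-realise : ∀ f f0≡0 → binaryRow (realise f f0≡0) ≗ f
  binaryRow-realise f f0≡0 b = begin
    finToFun (inject≤ (realise f f0≡0) T≤2^1+M) b  ≡⟨ cong (λ c → finToFun c b) inject≤-realise ⟩
    finToFun (funToFin f) b                       ≡⟨ finToFun-funToFin f b ⟩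
    f b                                           ∎
    where
    open ≡-Reasoning
    inject≤-realise : inject≤ (realise f f0≡0) T≤2^1+M ≡ funToFin f
    inject≤-realise = toℕ-injective (trans (toℕ-inject≤ _ T≤2^1+M) (toℕ-fromℕ< _))

  zeroType : Fin T
  zeroType = realise (const 0F) refl

  zeroType-row : ∀ b → binaryRow zeroType b ≡ 0F
  zeroType-row = binaryRow-realise (const 0F) refl

  unitType : Fin M → Fin T
  unitType c = realise (indicator (Fin.suc c)) refl

  unitType-row : ∀ c b → binaryRow (unitType c) b ≡ indicator (Fin.suc c) b
  unitType-row c = binaryRow-realise (indicator (Fin.suc c)) refl

  unitType-row-self : ∀ c → binaryRow (unitType c) (Fin.suc c) ≡ 1F
  unitType-row-self c = trans (unitType-row c (Fin.suc c)) (indicator-self (Fin.suc c))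

  unitType-row-other : ∀ {b} c → b ≢ Fin.suc c → binaryRow (unitType c) b ≡ 0F
  unitType-row-other {b} c b≢c = trans (unitType-row c b) (indicator-other b≢c)

  unitType-separates : ∀ {b} c → b ≢ Fin.suc c →
                       binaryRow (unitType c) b ≢ binaryRow (unitType c) (Fin.suc c)
  unitType-separates c b≢c rows≡ =
    ≡0F⇒≢1F (unitType-row-other c b≢c) (trans rows≡ (unitType-row-self c))

  unitType≢zeroType : ∀ c → unitType c ≢ zeroType
  unitType≢zeroType c unit≡zero = ≡0F⇒≢1F
    (trans (cong (λ τ → binaryRow τ (Fin.suc c)) unit≡zero) (zeroType-row (Fin.suc c)))
    (unitType-row-self c)

binaryTable : ∀ {M T} → 2 ≤ M → 2 ^ M ≤ T → T ≤ 2 ^ suc M → KeyTable (suc M) T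
binaryTable {M@(suc (suc _))} (s≤s (s≤s _)) 2^M≤T T≤2^1+M = record
  { row           = binaryRow
  ; row-injective = binaryRow-injective
  ; blank         = zeroType
  ; blank-row     = zeroType-row
  ; separating    = separating
  ; avoiding      = avoiding
  }
  where
  open BinaryRows {M} 2^M≤T T≤2^1+M

  separating : ∀ {b b′} → b ≢ b′ → ∃ λ τ → binaryRow τ b ≢ binaryRow τ b′
  separating {b}         {Fin.suc c} b≢b′ = unitType c , unitType-separates c b≢b′
  separating {Fin.suc c} {0F}        _    = unitType c , unitType-separates c 0≢1+n ∘ sym
  separating {0F}        {0F}        b≢b′ = contradiction refl b≢b′

  avoided-by : ∀ {b} c → b ≢ Fin.suc c → ∃ λ τ → τ ≢ zeroType × binaryRow τ b ≡ 0F
  avoided-by c b≢c = unitType c , unitType≢zeroType c , unitType-row-other c b≢c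

  avoiding : ∀ b → ∃ λ τ → τ ≢ zeroType × binaryRow τ b ≡ 0F
  avoiding b@0F                    = avoided-by {b} 0F 0≢1+n
  avoiding b@1F                    = avoided-by {b} 1F λ ()
  avoiding b@(Fin.suc (Fin.suc _)) = avoided-by {b} 0F λ ()

-- Choosing the number of keys

collapse : ∀ {T E} → Fin T → Fin (T + E) → Fin T
collapse {T} default = [ id , const default ]′ ∘ splitAt T

collapse-surjective : ∀ {T E} (default : Fin T) τ → ∃ λ j → collapse {T} {E} default j ≡ τ
collapse-surjective {T} {E} default τ = τ ↑ˡ E , cong [ id , const default ]′ (splitAt-↑ˡ T τ E)

NakS-atLeast-mono : ∀ {n t m m′} → m ≤ m′ → NakS-atLeast n t m′ → NakS-atLeast n t m
NakS-atLeast-mono m≤m′ (G , noVetoers , classes , ν , nakamura , m′≤ν) =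
  G , noVetoers , classes , ν , nakamura , ≤-trans m≤m′ m′≤ν

nakS-binary : ∀ {M t n} → 2 ≤ M → suc M + 2 ^ M ≤ t → t ≤ suc M + 2 ^ suc M → t ≤ n →
              NakS-atLeast n t (n ∸ suc M)
nakS-binary {M} {t} {n} 2≤M lo hi t≤n =
  subst₂ (λ n t → NakS-atLeast n t (n ∸ suc M)) n≡ t≡
    (NakS-atLeast-mono (≤-reflexive (m+n∸m≡n (suc M) (T + E)))
      (KeyGame.nakS-atLeast table (collapse blank) (collapse-surjective blank)
                            (proj₁ (proj₂ (avoiding 0F)))))
  where
  T = t ∸ suc M
  E = n ∸ t

  table : KeyTable (suc M) T
  table = binaryTable 2≤M (m+n≤o⇒m≤o∸n (2 ^ M) (subst (_≤ t) (+-comm (suc M) (2 ^ M)) lo))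
                          (m≤n+o⇒m∸n≤o t (suc M) hi)
  open KeyTable table using (blank; avoiding)

  t≡ : suc M + T ≡ t
  t≡ = m+[n∸m]≡n (m+n≤o⇒m≤o (suc M) lo)

  n≡ : suc M + (T + E) ≡ n
  n≡ = trans (sym (+-assoc (suc M) T E)) (trans (cong (_+ E) t≡) (m+[n∸m]≡n t≤n))

threshold-crossing : ∀ (g : ℕ → ℕ) {a b x} → a ≤ b → g a ≤ x → x < g b →
                     ∃ λ m → a ≤ m × m < b × g m ≤ x × x < g (suc m)
threshold-crossing g {b = zero} z≤n ga≤x x<gb = contradiction ga≤x (<⇒≱ x<gb)
threshold-crossing g {a} {suc b} {x} a≤1+b ga≤x x<g1+b with m≤n⇒m<n∨m≡n a≤1+b
... | inj₂ refl = contradiction ga≤x (<⇒≱ x<g1+b)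
... | inj₁ (s≤s a≤b) with x <? g b
...   | yes x<gb =
        let m , a≤m , m<b , crossing = threshold-crossing g a≤b ga≤x x<gb
        in  m , a≤m , ≤-trans m<b (n≤1+n b) , crossing
...   | no x≮gb = b , a≤b , ≤-refl , ≮⇒≥ x≮gb , x<g1+b

proposition8 : (k : ℕ) → 3 ≤ k → (t : ℕ) → 2 * k + 1 ≤ t → t ≤ k + 2 ^ k →
    (n : ℕ) → t ≤ n → NakS-atLeast n t (n ∸ k)
proposition8 k 3≤k t 2k+1≤t t≤k+2^k n t≤n
  with M , 2≤M , M<k , lo , hi ← threshold-crossing (λ m → suc m + 2 ^ m) (≤-trans (n≤1+n 2) 3≤k)
                                   (≤-trans (+-monoˡ-≤ 1 (*-monoʳ-≤ 2 3≤k)) 2k+1≤t) (s≤s t≤k+2^k)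
  = NakS-atLeast-mono (∸-monoʳ-≤ n M<k) (nakS-binary 2≤M lo (s≤s⁻¹ hi) t≤n)
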